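{- (i) If a nested canalyzing function $f$ of $n\ge2$ variables has a default-normalized representation consisting of $q$ layers, then $f$ is $2q$-symmetric and is not $(q-1)$-symmetric. (ii) Every $r$-symmetric nested canalyzing function of $n\ge 2$ variables has a default-normalized representation with at most $r$ layers.
   Context: A Boolean function $f(x_1,\dots,x_n)$ is nested canalyzing (an NCF) if there are a permutation $\pi$ of $\{1,\dots,n\}$, canalyzing values $a_1,\dots,a_n\in\{0,1\}$ and canalyzed values $b_1,\dots,b_n\in\{0,1\}$ such that $f$ is computed by the ordered list of rules "$x_{\pi(i)}: a_i\to b_i$" for $i=1,\dots,n$ followed by "Default: $\overline{b_n}$": $f(x)=b_i$ for the first $i$ with $x_{\pi(i)}=a_i$, and $f(x)=\overline{b_n}$ if $x_{\pi(i)}\neq a_i$ for all $i$. Such a list of $n$ lines is a representation of $f$. A layer of a representation is a maximal sequence of consecutive lines with the same canalyzed value. For $n\ge2$, a representation is default-normalized if lines $n-1$ and $n$ have the same canalyzed value. Two variables are symmetric if interchanging their values never changes the value of the function; $f$ is $r$-symmetric if its variables can be partitioned into at most $r$ groups such that any two variables in the same group are symmetric. -}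

module Defs where

open import Data.Nat using (ℕ; zero; suc; _+_)
open import Data.Bool using (Bool; true; false; not; if_then_else_; _≟_)
open import Data.Fin using (Fin)
import Data.Fin as Fin
open import Data.Fin.Permutation using (Permutation′; _⟨$⟩ʳ_)
open import Data.List using (List; []; _∷_; map)
open import Data.List.Base using (allFin)
open import Data.Product using (Σ; ∃; _×_; _,_)
open import Data.Empty using (⊥)
open import Relation.Binary.PropositionalEquality using (_≡_)
open import Relation.Nullary using (does)

BoolFun : ℕ → Set
BoolFun n = (Fin n → Bool) → Bool

-- A representation: permutation π of the variables, canalyzing values a i,
-- canalyzed values b i (line i is "x_{π(i)} : a i → b i").
record Rep (n : ℕ) : Set where
  field
    π : Permutation′ n
    a : Fin n → Bool
    b : Fin n → Bool

-- A single line: (variable, canalyzing value, canalyzed value)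
Line : ℕ → Set
Line n = Fin n × Bool × Bool

lines : ∀ {n} → Rep n → List (Line n)
lines {n} R = map (λ i → (π ⟨$⟩ʳ i , a i , b i)) (allFin n)
  where open Rep R

-- Evaluate a list of lines; after the last line (v : a → b) the default is not b.
-- (The empty list, i.e. n = 0, never occurs in the statement, which assumes n ≥ 2.)
evalLines : ∀ {n} → List (Line n) → (Fin n → Bool) → Bool
evalLines [] x = false
evalLines ((v , a , b) ∷ []) x = if does (x v ≟ a) then b else not b
evalLines ((v , a , b) ∷ l ∷ ls) x = if does (x v ≟ a) then b else evalLines (l ∷ ls) x

eval : ∀ {n} → Rep n → BoolFun n
eval R = evalLines (lines R)

Represents : ∀ {n} → Rep n → BoolFun n → Set
Represents R f = ∀ x → eval R x ≡ f x

IsNCF : ∀ {n} → BoolFun n → Set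
IsNCF {n} f = Σ (Rep n) λ R → Represents R f

canalyzedValues : ∀ {n} → Rep n → List Bool
canalyzedValues {n} R = map (Rep.b R) (allFin n)

countLayers : List Bool → ℕ
countLayers [] = 0
countLayers (_ ∷ []) = 1
countLayers (x ∷ y ∷ r) = (if does (x ≟ y) then 0 else 1) + countLayers (y ∷ r)

layers : ∀ {n} → Rep n → ℕ
layers R = countLayers (canalyzedValues R)

lastTwoEqual : List Bool → Set
lastTwoEqual [] = ⊥
lastTwoEqual (_ ∷ []) = ⊥
lastTwoEqual (x ∷ y ∷ []) = x ≡ y
lastTwoEqual (x ∷ y ∷ z ∷ r) = lastTwoEqual (y ∷ z ∷ r)

DefaultNormalized : ∀ {n} → Rep n → Set
DefaultNormalized R = lastTwoEqual (canalyzedValues R)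

swapVals : ∀ {n} → Fin n → Fin n → (Fin n → Bool) → (Fin n → Bool)
swapVals i j x k =
  if does (k Fin.≟ i) then x j else (if does (k Fin.≟ j) then x i else x k)

SymmetricVars : ∀ {n} → BoolFun n → Fin n → Fin n → Set
SymmetricVars f i j = ∀ x → f (swapVals i j x) ≡ f x

-- partition into at most r groups = labelling by Fin r (groups may be empty)
RSymmetric : ∀ {n} → ℕ → BoolFun n → Set
RSymmetric {n} r f =
  Σ (Fin n → Fin r) λ g → ∀ i j → g i ≡ g j → SymmetricVars f i j

-- Every line
-- (v , a , b) gets a label: twice the number of layer changes before it,
-- plus the bit of its canalyzing value a.  Labels of a representation with
-- q layers are below 2q, and two variables with the same label (same layer,
-- same canalyzing value) are symmetric; hence f is 2q-symmetric.
--
-- Conversely, in a default-normalized representation take the last variable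
-- of every layer but the final one, together with the variable of the
-- second-to-last line (which lies in the final layer): these q variables are
-- pairwise non-symmetric, because a variable at a layer boundary can be told
-- apart from every later variable, and fixing a leading variable to its
-- non-canalyzing value preserves non-symmetry.  By the pigeonhole principle
-- every r-symmetric NCF therefore has q ≤ r.  This gives "not (q-1)-symmetric"
-- in (i) and, since every representation of a function of n ≥ 2 variables can
-- be default-normalized by negating the last line, statement (ii).
module Submission where

open import Defs
open import Data.Nat using (ℕ; zero; suc; _+_; _*_; _∸_; _≤_; _<_; z≤n; s≤s; _≤?_)
open import Data.Nat.Properties
  using (≤-trans; m≤n+m; *-monoʳ-≤; *-suc; +-cancelˡ-≡; +-monoʳ-<; <-irrefl; ≰⇒>)
open import Data.Bool using (Bool; true; false; not; if_then_else_; _≟_)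
open import Data.Bool.Properties using (not-involutive; ¬-not)
open import Data.Fin using (Fin; toℕ; fromℕ<)
import Data.Fin as Fin
open import Data.Fin.Properties using (toℕ-fromℕ<; pigeonhole)
open import Data.Fin.Permutation using (_⟨$⟩ʳ_; _⟨$⟩ˡ_; inverseʳ)
open import Data.Vec.Functional using (updateAt)
open import Data.Vec.Functional.Properties using (updateAt-updates; updateAt-minimal)
open import Data.List using (List; []; _∷_; map; length; lookup; tabulate; allFin)
open import Data.List.Properties using (map-∘; map-tabulate)
open import Data.List.Relation.Unary.All using (All; []; _∷_)
import Data.List.Relation.Unary.All as All
open import Data.List.Relation.Unary.Any using (Any; here; there)
import Data.List.Relation.Unary.Any as Any
import Data.List.Relation.Unary.Any.Properties as Any
open import Data.List.Relation.Unary.AllPairs using (AllPairs; []; _∷_)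
import Data.List.Relation.Unary.AllPairs as AllPairs
import Data.List.Relation.Unary.AllPairs.Properties as AllPairs
import Data.List.Relation.Unary.Unique.Propositional.Properties as Unique
open import Data.List.Membership.Propositional.Properties using (∈-allFin; ∈-lookup)
open import Data.Product using (Σ; _×_; _,_)
open import Data.Empty using (⊥-elim)
open import Function using (id; const; _∘_)
open import Function.Bundles using (Injection)
open import Function.Properties.Inverse using (↔⇒↣)
open import Relation.Binary.PropositionalEquality
open import Relation.Nullary using (¬_; Dec; yes; no; does)
open import Relation.Nullary.Decidable using (dec-true; dec-false)

Asymmetric : ∀ {n} → BoolFun n → Fin n → Fin n → Set
Asymmetric f u w = ¬ SymmetricVars f u w

symmetric-ext : ∀ {n} {f f′ : BoolFun n} {u w} → (∀ x → f x ≡ f′ x) →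
                SymmetricVars f u w → SymmetricVars f′ u w
symmetric-ext {f = f} {f′} {u} {w} f≗f′ symm x = begin
  f′ (swapVals u w x) ≡⟨ sym (f≗f′ _) ⟩
  f (swapVals u w x)  ≡⟨ symm x ⟩
  f x                 ≡⟨ f≗f′ x ⟩
  f′ x                ∎
  where open ≡-Reasoning

allPairs-lookup : ∀ {A : Set} {R : A → A → Set} {xs : List A} {i j : Fin (length xs)} →
                  AllPairs R xs → i Fin.< j → R (lookup xs i) (lookup xs j)
allPairs-lookup {xs = _ ∷ _} {Fin.zero} {Fin.suc j} (r ∷ _) _ = All.lookup r (∈-lookup j)
allPairs-lookup {xs = _ ∷ _} {Fin.suc i} {Fin.suc j} (_ ∷ rs) (s≤s i<j) = allPairs-lookup rs i<j

asymmetric-bound : ∀ {n r} {f : BoolFun n} {ws : List (Fin n)} →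
                   AllPairs (Asymmetric f) ws → RSymmetric r f → length ws ≤ r
asymmetric-bound {r = r} {ws = ws} asym (group , symm) with length ws ≤? r
... | yes bound = bound
... | no ¬bound with pigeonhole (≰⇒> ¬bound) (group ∘ lookup ws)
...   | i , j , i<j , same = ⊥-elim (allPairs-lookup asym i<j (symm _ _ same))

countLayers-repeat : ∀ {c d} (r : List Bool) → c ≡ d → countLayers (c ∷ d ∷ r) ≡ countLayers (d ∷ r)
countLayers-repeat {c} {d} r c≡d = cong (λ t → (if t then 0 else 1) + countLayers (d ∷ r)) (dec-true (c ≟ d) c≡d)

countLayers-positive : ∀ (c : Bool) r → 0 < countLayers (c ∷ r)
countLayers-positive c [] = s≤s z≤n
countLayers-positive c (d ∷ r) = ≤-trans (countLayers-positive d r) (m≤n+m _ _)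

≡not⇒≢ : ∀ {c a} → c ≡ not a → c ≢ a
≡not⇒≢ {a = false} refl ()
≡not⇒≢ {a = true} refl ()

bit : Bool → ℕ
bit false = 0
bit true = 1

bit-injective : ∀ {c d} → bit c ≡ bit d → c ≡ d
bit-injective {false} {false} _ = refl
bit-injective {true} {true} _ = refl

bit<2 : ∀ c → bit c < 2
bit<2 false = s≤s z≤n
bit<2 true = s≤s (s≤s z≤n)

bit≢2+ : ∀ c k → bit c ≢ 2 + k
bit≢2+ false k ()
bit≢2+ true k ()

module _ {n : ℕ} where

  _[_≔_] : (Fin n → Bool) → Fin n → Bool → Fin n → Bool
  x [ v ≔ c ] = updateAt x v (const c)

  set-same : ∀ x v c → (x [ v ≔ c ]) v ≡ c
  set-same x v c = updateAt-updates v x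

  set-other : ∀ x v c {k} → k ≢ v → (x [ v ≔ c ]) k ≡ x k
  set-other x v c k≢v = updateAt-minimal _ v x k≢v

  swap-left : ∀ i j x → swapVals {n} i j x i ≡ x j
  swap-left i j x with i Fin.≟ i
  ... | yes _ = refl
  ... | no i≢i = ⊥-elim (i≢i refl)

  swap-right : ∀ i j x → swapVals {n} i j x j ≡ x i
  swap-right i j x with j Fin.≟ i
  ... | yes refl = refl
  ... | no _ with j Fin.≟ j
  ...   | yes _ = refl
  ...   | no j≢j = ⊥-elim (j≢j refl)

  swap-other : ∀ i j x {k} → k ≢ i → k ≢ j → swapVals {n} i j x k ≡ x k
  swap-other i j x {k} k≢i k≢j with k Fin.≟ i
  ... | yes k≡i = ⊥-elim (k≢i k≡i)
  ... | no _ with k Fin.≟ j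
  ...   | yes k≡j = ⊥-elim (k≢j k≡j)
  ...   | no _ = refl

  swap-trivial : ∀ i j x → x i ≡ x j → ∀ k → swapVals {n} i j x k ≡ x k
  swap-trivial i j x xi≡xj k with k Fin.≟ i
  ... | yes refl = sym xi≡xj
  ... | no _ with k Fin.≟ j
  ...   | yes refl = xi≡xj
  ...   | no _ = refl

  swap-comm : ∀ i j x k → swapVals {n} i j x k ≡ swapVals j i x k
  swap-comm i j x k with k Fin.≟ i | k Fin.≟ j
  ... | yes refl | yes refl = refl
  ... | yes refl | no _ = refl
  ... | no _ | yes refl = refl
  ... | no _ | no _ = refl

  swap-agree-off : ∀ i j v x x′ → i ≢ v → j ≢ v → (∀ k → k ≢ v → x k ≡ x′ k) →
                   ∀ k → k ≢ v → swapVals {n} i j x k ≡ swapVals i j x′ k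
  swap-agree-off i j v x x′ i≢v j≢v agree k k≢v with k Fin.≟ i
  ... | yes _ = agree j j≢v
  ... | no _ with k Fin.≟ j
  ...   | yes _ = agree i i≢v
  ...   | no _ = agree k k≢v

  var : Line n → Fin n
  var (v , _ , _) = v

  canalyzed : Line n → Bool
  canalyzed (_ , _ , b) = b

  Occurs : Fin n → List (Line n) → Set
  Occurs u L = Any (λ l → var l ≡ u) L

  Fresh : Fin n → List (Line n) → Set
  Fresh v L = All (λ l → v ≢ var l) L

  DistinctVars : List (Line n) → Set
  DistinctVars = AllPairs (λ l l′ → var l ≢ var l′)

  fresh-occurs : ∀ {v u L} → Fresh v L → Occurs u L → v ≢ u
  fresh-occurs (v≢ ∷ _) (here refl) = v≢
  fresh-occurs (_ ∷ fresh) (there occ) = fresh-occurs fresh occ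

  evalLines-local : ∀ L {z z′} → (∀ u → Occurs u L → z u ≡ z′ u) → evalLines L z ≡ evalLines L z′
  evalLines-local [] _ = refl
  evalLines-local ((v , a , b) ∷ []) agree =
    cong (λ c → if does (c ≟ a) then b else not b) (agree v (here refl))
  evalLines-local ((v , a , b) ∷ l ∷ L) agree =
    cong₂ (λ c e → if does (c ≟ a) then b else e) (agree v (here refl))
          (evalLines-local (l ∷ L) (λ u → agree u ∘ there))

  evalLines-off : ∀ {v} L {z z′} → Fresh v L → (∀ k → k ≢ v → z k ≡ z′ k) →
                  evalLines L z ≡ evalLines L z′
  evalLines-off L fresh agree = evalLines-local L (λ u occ → agree u (fresh-occurs fresh occ ∘ sym))

  fires : ∀ (v : Fin n) {a b} L z → z v ≡ a → evalLines ((v , a , b) ∷ L) z ≡ b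
  fires v {a} [] z zv≡a rewrite dec-true (z v ≟ a) zv≡a = refl
  fires v {a} (_ ∷ _) z zv≡a rewrite dec-true (z v ≟ a) zv≡a = refl

  skips : ∀ (v : Fin n) {a b} l L z → z v ≢ a → evalLines ((v , a , b) ∷ l ∷ L) z ≡ evalLines (l ∷ L) z
  skips v {a} l L z zv≢a rewrite dec-false (z v ≟ a) zv≢a = refl

  fires-unless-skipped : ∀ {v : Fin n} {a b} l L z → (z v ≢ a → evalLines (l ∷ L) z ≡ b) →
                         evalLines ((v , a , b) ∷ l ∷ L) z ≡ b
  fires-unless-skipped {v} {a} l L z skipped with z v ≟ a
  ... | yes _ = refl
  ... | no zv≢a = skipped zv≢a

  skips-last : ∀ {v : Fin n} {a b} z → z v ≢ a → evalLines ((v , a , b) ∷ []) z ≡ not b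
  skips-last {v} {a} z zv≢a rewrite dec-false (z v ≟ a) zv≢a = refl

  skip-into : ∀ {v : Fin n} {a b} l L z z′ → Fresh v (l ∷ L) → z v ≢ a → (∀ k → k ≢ v → z k ≡ z′ k) →
              evalLines ((v , a , b) ∷ l ∷ L) z ≡ evalLines (l ∷ L) z′
  skip-into l L z z′ fresh zv≢a agree = trans (skips _ l L z zv≢a) (evalLines-off (l ∷ L) fresh agree)

  evalLines-onto : ∀ l L → DistinctVars (l ∷ L) → ∀ c → Σ (Fin n → Bool) λ z → evalLines (l ∷ L) z ≡ c
  evalLines-onto (v , a , b) [] _ c with c ≟ b
  ... | yes refl = const a , fires v [] (const a) refl
  ... | no c≢b = const (not a) , trans (skips-last {v = v} (const (not a)) (≡not⇒≢ refl)) (sym (¬-not c≢b))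
  evalLines-onto (v , a , b) (l ∷ L) (fresh ∷ distinct) c with evalLines-onto l L distinct c
  ... | z , z↦c = z [ v ≔ not a ] ,
                  trans (skip-into l L (z [ v ≔ not a ]) z fresh (≡not⇒≢ (set-same z v (not a)))
                                   (λ k → set-other z v (not a)))
                        z↦c

  -- Labels: 2 × (number of layer changes before the line of u) + bit of its canalyzing value.
  layerShift : Bool → List (Line n) → ℕ
  layerShift b [] = 0
  layerShift b (l ∷ L) = if does (b ≟ canalyzed l) then 0 else 2

  label : List (Line n) → Fin n → ℕ
  label [] u = 0
  label ((v , a , b) ∷ L) u = if does (u Fin.≟ v) then bit a else layerShift b L + label L u

  label-bound : ∀ L {u} → Occurs u L → label L u < 2 * countLayers (map canalyzed L)
  label-bound ((v , a , b) ∷ L) {u} occ with u Fin.≟ v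
  ... | yes _ = ≤-trans (bit<2 a) (*-monoʳ-≤ 2 (countLayers-positive b (map canalyzed L)))
  label-bound ((v , a , b) ∷ []) (here refl) | no u≢v = ⊥-elim (u≢v refl)
  label-bound ((v , a , b) ∷ (v′ , a′ , b′) ∷ L) (here refl) | no u≢v = ⊥-elim (u≢v refl)
  label-bound ((v , a , b) ∷ (v′ , a′ , b′) ∷ L) {u} (there occ) | no _ with b ≟ b′
  ... | yes _ = label-bound ((v′ , a′ , b′) ∷ L) occ
  ... | no _ = subst (2 + label ((v′ , a′ , b′) ∷ L) u <_)
                     (sym (*-suc 2 (countLayers (b′ ∷ map canalyzed L))))
                     (+-monoʳ-< 2 (label-bound ((v′ , a′ , b′) ∷ L) occ))

  -- A variable with label bit c lies in the first layer with canalyzing value c,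
  -- so setting it to c yields the canalyzed value of the first layer.
  first-layer-fires : ∀ l L {w c} z → Occurs w (l ∷ L) → label (l ∷ L) w ≡ bit c → z w ≡ c →
                      evalLines (l ∷ L) z ≡ canalyzed l
  first-layer-fires (v , a , b) L {w} z occ lab zw≡c with w Fin.≟ v
  ... | yes refl = fires w L z (trans zw≡c (sym (bit-injective lab)))
  first-layer-fires (v , a , b) [] z (here refl) lab zw≡c | no w≢v = ⊥-elim (w≢v refl)
  first-layer-fires (v , a , b) (l ∷ L) z (here refl) lab zw≡c | no w≢v = ⊥-elim (w≢v refl)
  first-layer-fires (v , a , b) ((v′ , a′ , b′) ∷ L) {c = c} z (there occ) lab zw≡c | no _
    with b ≟ b′
  ... | no _ = ⊥-elim (bit≢2+ c _ (sym lab))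
  ... | yes refl = fires-unless-skipped _ L z (λ _ → first-layer-fires (v′ , a′ , b) L z occ lab zw≡c)

  shared-layer-fires : ∀ (v : Fin n) a b l L {w z} → Occurs w (l ∷ L) → canalyzed l ≡ b →
                       label (l ∷ L) w ≡ bit a → z w ≡ a → evalLines ((v , a , b) ∷ l ∷ L) z ≡ b
  shared-layer-fires v a b l L {z = z} occ same-layer lab zw≡a =
    fires-unless-skipped l L z (λ _ → trans (first-layer-fires l L z occ lab zw≡a) same-layer)

  -- Hence v and such a w are symmetric: the result is b as soon as v or w
  -- takes the value a, and otherwise interchanging them changes nothing.
  head-symmetric : ∀ (v : Fin n) a b l L {w} → Occurs w (l ∷ L) → canalyzed l ≡ b → label (l ∷ L) w ≡ bit a →
                   SymmetricVars (evalLines ((v , a , b) ∷ l ∷ L)) v w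
  head-symmetric v a b l L {w} occ same-layer lab x = by-cases (x v ≟ a) (x w ≟ a)
    where
    F = evalLines ((v , a , b) ∷ l ∷ L)
    by-cases : Dec (x v ≡ a) → Dec (x w ≡ a) → F (swapVals v w x) ≡ F x
    by-cases (yes xv≡a) _ =
      trans (shared-layer-fires v a b l L occ same-layer lab (trans (swap-right v w x) xv≡a))
            (sym (fires v (l ∷ L) x xv≡a))
    by-cases (no _) (yes xw≡a) =
      trans (fires v (l ∷ L) (swapVals v w x) (trans (swap-left v w x) xw≡a))
            (sym (shared-layer-fires v a b l L occ same-layer lab xw≡a))
    by-cases (no xv≢a) (no xw≢a) =
      evalLines-local ((v , a , b) ∷ l ∷ L)
        (λ u _ → swap-trivial v w x (trans (¬-not xv≢a) (sym (¬-not xw≢a))) u)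

  -- A line whose variable is neither u nor w does not affect their symmetry
  -- (u occurring in L makes L nonempty, so the line is not the last one).
  symmetric-cons : ∀ (v : Fin n) a b L {u w} → v ≢ u → v ≢ w → Occurs u L →
                   SymmetricVars (evalLines L) u w → SymmetricVars (evalLines ((v , a , b) ∷ L)) u w
  symmetric-cons v a b (l ∷ L) {u} {w} v≢u v≢w _ symm x =
    cong₂ (λ c e → if does (c ≟ a) then b else e) (swap-other u w x v≢u v≢w) (symm x)

  occurs-tail : ∀ {u} {l : Line n} {L} → Occurs u (l ∷ L) → var l ≢ u → Occurs u L
  occurs-tail (here v≡u) v≢u = ⊥-elim (v≢u v≡u)
  occurs-tail (there occ) _ = occ

  head-symmetric-by-label : ∀ (v : Fin n) a b L {w} → Occurs w L → bit a ≡ layerShift b L + label L w →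
                            SymmetricVars (evalLines ((v , a , b) ∷ L)) v w
  head-symmetric-by-label v a b ((v′ , a′ , b′) ∷ L) occ same with b ≟ b′
  ... | yes refl = head-symmetric v a b (v′ , a′ , b) L occ refl (sym same)
  ... | no _ = ⊥-elim (bit≢2+ a _ same)

  label-symmetric : ∀ L {u w} → Occurs u L → Occurs w L → label L u ≡ label L w →
                    SymmetricVars (evalLines L) u w
  label-symmetric ((v , a , b) ∷ L) {u} {w} occ-u occ-w same with u Fin.≟ v | w Fin.≟ v
  ... | yes refl | yes refl = λ x → evalLines-local ((u , a , b) ∷ L) (λ k _ → swap-trivial u u x refl k)
  ... | yes refl | no w≢v = head-symmetric-by-label u a b L (occurs-tail occ-w (w≢v ∘ sym)) same
  ... | no u≢v | yes refl = λ x →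
    trans (evalLines-local ((w , a , b) ∷ L) (λ k _ → swap-comm u w x k))
          (head-symmetric-by-label w a b L (occurs-tail occ-u (u≢v ∘ sym)) (sym same) x)
  ... | no u≢v | no w≢v =
    symmetric-cons v a b L (u≢v ∘ sym) (w≢v ∘ sym) occ-u′
      (label-symmetric L occ-u′ (occurs-tail occ-w (w≢v ∘ sym)) (+-cancelˡ-≡ (layerShift b L) _ _ same))
    where
    occ-u′ = occurs-tail occ-u (u≢v ∘ sym)

  -- Fixing a fresh leading variable to its non-canalyzing value shows that
  -- asymmetry of two tail variables persists when the line is added.
  asymmetric-cons : ∀ (v : Fin n) a b l L {u w} → Fresh v (l ∷ L) → v ≢ u → v ≢ w →
                    Asymmetric (evalLines (l ∷ L)) u w → Asymmetric (evalLines ((v , a , b) ∷ l ∷ L)) u w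
  asymmetric-cons v a b l L {u} {w} fresh v≢u v≢w asym symm = asym λ x →
    let x̂ = x [ v ≔ not a ]
        x̂≈x : ∀ k → k ≢ v → x̂ k ≡ x k
        x̂≈x k = set-other x v (not a)
        swapped-skips : swapVals u w x̂ v ≢ a
        swapped-skips = ≡not⇒≢ (trans (swap-other u w x̂ v≢u v≢w) (set-same x v (not a)))
    in begin
      evalLines (l ∷ L) (swapVals u w x)
        ≡⟨ sym (skip-into l L (swapVals u w x̂) (swapVals u w x) fresh swapped-skips
                  (swap-agree-off u w v x̂ x (v≢u ∘ sym) (v≢w ∘ sym) x̂≈x)) ⟩
      evalLines ((v , a , b) ∷ l ∷ L) (swapVals u w x̂)
        ≡⟨ symm x̂ ⟩
      evalLines ((v , a , b) ∷ l ∷ L) x̂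
        ≡⟨ skip-into l L x̂ x fresh (≡not⇒≢ (set-same x v (not a))) x̂≈x ⟩
      evalLines (l ∷ L) x ∎
    where open ≡-Reasoning

  asymmetric-pairs-cons : ∀ (v : Fin n) a b l L {ws} → Fresh v (l ∷ L) → All (λ w → Occurs w (l ∷ L)) ws →
                          AllPairs (Asymmetric (evalLines (l ∷ L))) ws →
                          AllPairs (Asymmetric (evalLines ((v , a , b) ∷ l ∷ L))) ws
  asymmetric-pairs-cons v a b l L fresh [] [] = []
  asymmetric-pairs-cons v a b l L fresh (occ ∷ occs) (asym ∷ asyms) =
    All.zipWith (λ (occ′ , asym′) →
                   asymmetric-cons v a b l L fresh (fresh-occurs fresh occ) (fresh-occurs fresh occ′) asym′)
                (occs , asym)
    ∷ asymmetric-pairs-cons v a b l L fresh occs asyms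

  separated-by : ∀ (v : Fin n) a b v₁ a₁ b₁ L {w} x → b ≢ b₁ → x v ≢ a → x v₁ ≡ a₁ → x w ≡ a →
                 Asymmetric (evalLines ((v , a , b) ∷ (v₁ , a₁ , b₁) ∷ L)) v w
  separated-by v a b v₁ a₁ b₁ L {w} x b≢b₁ xv≢a xv₁≡a₁ xw≡a symm = b≢b₁ (begin
    b                                     ≡⟨ sym (fires v ((v₁ , a₁ , b₁) ∷ L) (swapVals v w x) swapped-fires) ⟩
    F (swapVals v w x)                    ≡⟨ symm x ⟩
    F x                                   ≡⟨ skips v _ L x xv≢a ⟩
    evalLines ((v₁ , a₁ , b₁) ∷ L) x      ≡⟨ fires v₁ L x xv₁≡a₁ ⟩
    b₁                                    ∎)
    where
    open ≡-Reasoning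
    F = evalLines ((v , a , b) ∷ (v₁ , a₁ , b₁) ∷ L)
    swapped-fires : swapVals v w x v ≡ a
    swapped-fires = trans (swap-left v w x) xw≡a

  -- If moreover a ≢ a₁, interchanging v and v₁ makes both leading lines skip,
  -- so v and v₁ are separated as soon as the remaining lines can produce b₁.
  separated-heads : ∀ (v : Fin n) a b v₁ a₁ b₁ l L → Fresh v (l ∷ L) → Fresh v₁ (l ∷ L) → v ≢ v₁ →
                    DistinctVars (l ∷ L) → a ≢ a₁ → b ≢ b₁ →
                    Asymmetric (evalLines ((v , a , b) ∷ (v₁ , a₁ , b₁) ∷ l ∷ L)) v v₁
  separated-heads v a b v₁ a₁ b₁ l L v∉ v₁∉ v≢v₁ distinct a≢a₁ b≢b₁ symm with evalLines-onto l L distinct b₁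
  ... | y , y↦b₁ = b≢b₁ (begin
    b                                      ≡⟨ sym (fires v ((v₁ , a₁ , b₁) ∷ l ∷ L) x (set-same _ v a)) ⟩
    F x                                    ≡⟨ sym (symm x) ⟩
    F x′                                   ≡⟨ skips v (v₁ , a₁ , b₁) (l ∷ L) x′ (λ e → a≢a₁ (trans (sym e) x′v≡a₁)) ⟩
    evalLines ((v₁ , a₁ , b₁) ∷ l ∷ L) x′  ≡⟨ skips v₁ l L x′ (λ e → a≢a₁ (trans (sym x′v₁≡a) e)) ⟩
    evalLines (l ∷ L) x′                   ≡⟨ evalLines-local (l ∷ L) x′≈y ⟩
    evalLines (l ∷ L) y                    ≡⟨ y↦b₁ ⟩
    b₁                                     ∎)
    where
    open ≡-Reasoning
    F = evalLines ((v , a , b) ∷ (v₁ , a₁ , b₁) ∷ l ∷ L)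
    x x′ : Fin n → Bool
    x = (y [ v₁ ≔ a₁ ]) [ v ≔ a ]
    x′ = swapVals v v₁ x
    x′v≡a₁ : x′ v ≡ a₁
    x′v≡a₁ = trans (swap-left v v₁ x) (trans (set-other _ v a (v≢v₁ ∘ sym)) (set-same y v₁ a₁))
    x′v₁≡a : x′ v₁ ≡ a
    x′v₁≡a = trans (swap-right v v₁ x) (set-same _ v a)
    x′≈y : ∀ k → Occurs k (l ∷ L) → x′ k ≡ y k
    x′≈y k occ = begin
      x′ k                      ≡⟨ swap-other v v₁ x (k≢v ∘ sym) (k≢v₁ ∘ sym) ⟩
      x k                       ≡⟨ set-other _ v a (k≢v ∘ sym) ⟩
      (y [ v₁ ≔ a₁ ]) k         ≡⟨ set-other y v₁ a₁ (k≢v₁ ∘ sym) ⟩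
      y k                       ∎
      where
      k≢v = fresh-occurs v∉ occ
      k≢v₁ = fresh-occurs v₁∉ occ

  -- The last variable v of a layer is asymmetric to every later variable,
  -- provided at least two lines follow it (a single last line could be negated
  -- into v's layer; this is where default-normalization enters).
  boundary-asymmetric : ∀ (v : Fin n) a b v₁ a₁ b₁ l L →
                        DistinctVars ((v , a , b) ∷ (v₁ , a₁ , b₁) ∷ l ∷ L) → b ≢ b₁ → ∀ {w} →
                        Occurs w ((v₁ , a₁ , b₁) ∷ l ∷ L) →
                        Asymmetric (evalLines ((v , a , b) ∷ (v₁ , a₁ , b₁) ∷ l ∷ L)) v w
  boundary-asymmetric v a b v₁ a₁ b₁ l L ((v≢v₁ ∷ v∉) ∷ (v₁∉ ∷ distinct)) b≢b₁ occ = by-cases occ (a ≟ a₁)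
    where
    x₀ : Fin n → Bool
    x₀ = ((const a) [ v₁ ≔ a₁ ]) [ v ≔ not a ]
    x₀-skips : x₀ v ≢ a
    x₀-skips = ≡not⇒≢ (set-same _ v (not a))
    x₀-fires : x₀ v₁ ≡ a₁
    x₀-fires = trans (set-other _ v (not a) (v≢v₁ ∘ sym)) (set-same _ v₁ a₁)
    by-cases : ∀ {w} → Occurs w ((v₁ , a₁ , b₁) ∷ l ∷ L) → Dec (a ≡ a₁) →
               Asymmetric (evalLines ((v , a , b) ∷ (v₁ , a₁ , b₁) ∷ l ∷ L)) v w
    by-cases (here refl) (yes refl) = separated-by v a b v₁ a b₁ (l ∷ L) x₀ b≢b₁ x₀-skips x₀-fires x₀-fires
    by-cases (here refl) (no a≢a₁) =
      separated-heads v a b v₁ a₁ b₁ l L v∉ v₁∉ v≢v₁ distinct a≢a₁ b≢b₁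
    by-cases {w} (there occ) _ = separated-by v a b v₁ a₁ b₁ (l ∷ L) x₀ b≢b₁ x₀-skips x₀-fires x₀w≡a
      where
      x₀w≡a : x₀ w ≡ a
      x₀w≡a = trans (set-other _ v (not a) (fresh-occurs v∉ occ ∘ sym))
                    (set-other _ v₁ a₁ (fresh-occurs v₁∉ occ ∘ sym))

  -- In lines with distinct variables whose last two lines share a layer, the
  -- last variable of each layer but the final one, together with the variable
  -- of the second-to-last line, form as many pairwise asymmetric variables as
  -- there are layers.
  layer-representatives : ∀ L → DistinctVars L → lastTwoEqual (map canalyzed L) →
    Σ (List (Fin n)) λ ws → length ws ≡ countLayers (map canalyzed L) ×
                            All (λ w → Occurs w L) ws × AllPairs (Asymmetric (evalLines L)) ws
  layer-representatives ((v , a , b) ∷ (v′ , a′ , b′) ∷ []) _ b≡b′ =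
    (v ∷ []) , sym (countLayers-repeat [] b≡b′) , (here refl ∷ []) , ([] ∷ [])
  layer-representatives ((v , a , b) ∷ (v₁ , a₁ , b₁) ∷ l ∷ L) distinct@(fresh ∷ distinct′) last-layer
    with layer-representatives ((v₁ , a₁ , b₁) ∷ l ∷ L) distinct′ last-layer
  ... | ws , count , occs , asym with b ≟ b₁
  ...   | yes _ = ws , count , All.map there occs , asymmetric-pairs-cons v a b _ _ fresh occs asym
  ...   | no b≢b₁ = (v ∷ ws) , cong suc count , (here refl ∷ All.map there occs) ,
                    (All.map (boundary-asymmetric v a b v₁ a₁ b₁ l L distinct b≢b₁) occs
                     ∷ asymmetric-pairs-cons v a b _ _ fresh occs asym)

  -- Negating canalyzing and canalyzed value of the last line does not change
  -- the function; it is how a representation is default-normalized.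
  flipLine : Line n → Line n
  flipLine (v , a , b) = (v , not a , not b)

  flipLast : List (Line n) → List (Line n)
  flipLast [] = []
  flipLast (l ∷ []) = flipLine l ∷ []
  flipLast (l ∷ l′ ∷ L) = l ∷ flipLast (l′ ∷ L)

  flip-single : ∀ c a b → (if does (c ≟ not a) then not b else not (not b)) ≡ (if does (c ≟ a) then b else not b)
  flip-single false false b = not-involutive b
  flip-single false true b = refl
  flip-single true false b = refl
  flip-single true true b = not-involutive b

  flipLast-eval : ∀ L x → evalLines (flipLast L) x ≡ evalLines L x
  flipLast-eval [] x = refl
  flipLast-eval ((v , a , b) ∷ []) x = flip-single (x v) a b
  flipLast-eval ((v , a , b) ∷ l ∷ []) x =
    cong (λ e → if does (x v ≟ a) then b else e) (flipLast-eval (l ∷ []) x)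
  flipLast-eval ((v , a , b) ∷ l ∷ l′ ∷ L) x =
    cong (λ e → if does (x v ≟ a) then b else e) (flipLast-eval (l ∷ l′ ∷ L) x)

  flipLast-normalizes : ∀ l l′ L → ¬ lastTwoEqual (map canalyzed (l ∷ l′ ∷ L)) →
                        lastTwoEqual (map canalyzed (flipLast (l ∷ l′ ∷ L)))
  flipLast-normalizes l l′ [] unequal = ¬-not unequal
  flipLast-normalizes l l′ (l″ ∷ []) unequal = flipLast-normalizes l′ l″ [] unequal
  flipLast-normalizes l l′ (l″ ∷ l‴ ∷ L) unequal = flipLast-normalizes l′ l″ (l‴ ∷ L) unequal

lastTwoEqual? : ∀ cs → Dec (lastTwoEqual cs)
lastTwoEqual? [] = no id
lastTwoEqual? (_ ∷ []) = no id
lastTwoEqual? (c ∷ d ∷ []) = c ≟ d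
lastTwoEqual? (_ ∷ d ∷ e ∷ cs) = lastTwoEqual? (d ∷ e ∷ cs)

lastTwoEqual⇒layers-positive : ∀ cs → lastTwoEqual cs → 0 < countLayers cs
lastTwoEqual⇒layers-positive [] ()
lastTwoEqual⇒layers-positive (c ∷ cs) _ = countLayers-positive c cs

module _ {n : ℕ} (R : Rep n) where
  open Rep R

  canalyzedValues-lines : canalyzedValues R ≡ map canalyzed (lines R)
  canalyzedValues-lines = map-∘ (allFin n)

  lines-distinct : DistinctVars (lines R)
  lines-distinct = AllPairs.map⁺ (AllPairs.map (λ i≢j → i≢j ∘ Injection.injective (↔⇒↣ π)) (Unique.allFin⁺ n))

  occurs-in-lines : ∀ u → Occurs u (lines R)
  occurs-in-lines u = Any.map⁺ (Any.map (λ i≡ → trans (cong (π ⟨$⟩ʳ_) (sym i≡)) (inverseʳ π)) (∈-allFin (π ⟨$⟩ˡ u)))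

  symmetric-by-layers : ∀ {f} → Represents R f → RSymmetric (2 * layers R) f
  symmetric-by-layers {f} represents = group , group-symmetric
    where
    label-bounded : ∀ u → label (lines R) u < 2 * layers R
    label-bounded u = subst (λ cs → label (lines R) u < 2 * countLayers cs) (sym canalyzedValues-lines)
                            (label-bound (lines R) (occurs-in-lines u))
    group : Fin n → Fin (2 * layers R)
    group u = fromℕ< (label-bounded u)
    group-symmetric : ∀ i j → group i ≡ group j → SymmetricVars f i j
    group-symmetric i j same =
      symmetric-ext represents
        (label-symmetric (lines R) (occurs-in-lines i) (occurs-in-lines j)
          (trans (sym (toℕ-fromℕ< (label-bounded i))) (trans (cong toℕ same) (toℕ-fromℕ< (label-bounded j)))))

  -- Lower bound: a default-normalized representation with q layers has q
  -- pairwise asymmetric variables, so no labelling with fewer than q groups exists.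
  layers-bound-symmetry : ∀ {f r} → Represents R f → DefaultNormalized R → RSymmetric r f → layers R ≤ r
  layers-bound-symmetry {f} represents normalized symmetric
    with layer-representatives (lines R) lines-distinct (subst lastTwoEqual canalyzedValues-lines normalized)
  ... | ws , count , _ , asym =
    subst (_≤ _) (trans count (cong countLayers (sym canalyzedValues-lines)))
          (asymmetric-bound (AllPairs.map (λ asym′ → asym′ ∘ symmetric-ext (sym ∘ represents)) asym) symmetric)

flipAtLast : ∀ {m} → (Fin (suc m) → Bool) → Fin (suc m) → Bool
flipAtLast {zero} g i = not (g i)
flipAtLast {suc m} g Fin.zero = g Fin.zero
flipAtLast {suc m} g (Fin.suc i) = flipAtLast (g ∘ Fin.suc) i

tabulate-flipAtLast : ∀ {n m} (p : Fin (suc m) → Fin n) (a b : Fin (suc m) → Bool) →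
                      tabulate (λ i → (p i , flipAtLast a i , flipAtLast b i))
                      ≡ flipLast (tabulate (λ i → (p i , a i , b i)))
tabulate-flipAtLast {m = zero} p a b = refl
tabulate-flipAtLast {m = suc m} p a b =
  cong ((p Fin.zero , a Fin.zero , b Fin.zero) ∷_) (tabulate-flipAtLast (p ∘ Fin.suc) (a ∘ Fin.suc) (b ∘ Fin.suc))

flipLastRep : ∀ {m} → Rep (suc m) → Rep (suc m)
flipLastRep R = record { π = Rep.π R ; a = flipAtLast (Rep.a R) ; b = flipAtLast (Rep.b R) }

lines-flipLastRep : ∀ {m} (R : Rep (suc m)) → lines (flipLastRep R) ≡ flipLast (lines R)
lines-flipLastRep R = begin
  lines (flipLastRep R)                             ≡⟨ map-tabulate id _ ⟩
  tabulate (λ i → (π ⟨$⟩ʳ i , flipAtLast a i , flipAtLast b i)) ≡⟨ tabulate-flipAtLast (π ⟨$⟩ʳ_) a b ⟩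
  flipLast (tabulate (λ i → (π ⟨$⟩ʳ i , a i , b i))) ≡⟨ cong flipLast (sym (map-tabulate id _)) ⟩
  flipLast (lines R)                                ∎
  where
  open ≡-Reasoning
  open Rep R

default-normalization : ∀ {k} (R : Rep (suc (suc k))) →
                        Σ (Rep (suc (suc k))) λ R′ → (∀ x → eval R′ x ≡ eval R x) × DefaultNormalized R′
default-normalization R with lastTwoEqual? (canalyzedValues R)
... | yes normalized = R , (λ _ → refl) , normalized
... | no unnormalized = flipLastRep R , same-function , normalized
  where
  same-function : ∀ x → eval (flipLastRep R) x ≡ eval R x
  same-function x = trans (cong (λ L → evalLines L x) (lines-flipLastRep R)) (flipLast-eval (lines R) x)
  canalyzed-flipped : canalyzedValues (flipLastRep R) ≡ map canalyzed (flipLast (lines R))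
  canalyzed-flipped = trans (canalyzedValues-lines (flipLastRep R)) (cong (map canalyzed) (lines-flipLastRep R))
  -- lines R unfolds to line 0 ∷ line 1 ∷ …, as flipLast-normalizes requires
  line : Fin (suc (suc _)) → Line (suc (suc _))
  line i = (Rep.π R ⟨$⟩ʳ i , Rep.a R i , Rep.b R i)
  normalized : DefaultNormalized (flipLastRep R)
  normalized = subst lastTwoEqual (sym canalyzed-flipped)
    (flipLast-normalizes (line Fin.zero) (line (Fin.suc Fin.zero)) (map line (tabulate (Fin.suc ∘ Fin.suc)))
                         (unnormalized ∘ subst lastTwoEqual (sym (canalyzedValues-lines R))))

positive⇒≰pred : ∀ {q} → 0 < q → ¬ q ≤ q ∸ 1
positive⇒≰pred {suc q} _ = <-irrefl refl

layers-determine-symmetry : (n : ℕ) → 2 ≤ n → (f : BoolFun n) → (R : Rep n) → (q : ℕ) →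
                            Represents R f → DefaultNormalized R → layers R ≡ q →
                            RSymmetric (2 * q) f × ¬ RSymmetric (q ∸ 1) f
layers-determine-symmetry n _ f R q represents normalized refl =
  symmetric-by-layers R represents ,
  λ fewer → positive⇒≰pred (lastTwoEqual⇒layers-positive (canalyzedValues R) normalized)
                           (layers-bound-symmetry R represents normalized fewer)

symmetric-NCF-has-few-layers : (n : ℕ) → 2 ≤ n → (r : ℕ) → (f : BoolFun n) →
                               IsNCF f → RSymmetric r f →
                               Σ (Rep n) λ R → Represents R f × DefaultNormalized R × layers R ≤ r
symmetric-NCF-has-few-layers (suc zero) (s≤s ()) _ _ _ _
symmetric-NCF-has-few-layers (suc (suc k)) _ r f (R , represents) symmetric with default-normalization R
... | R′ , same-function , normalized =
  R′ , represents′ , normalized , layers-bound-symmetry R′ represents′ normalized symmetric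
  where
  represents′ : Represents R′ f
  represents′ x = trans (same-function x) (represents x)

corollary2 : ((n : ℕ) → 2 ≤ n → (f : BoolFun n) → (R : Rep n) → (q : ℕ) →
    Represents R f → DefaultNormalized R → layers R ≡ q →
    RSymmetric (2 * q) f × ¬ RSymmetric (q ∸ 1) f)
    ×
    ((n : ℕ) → 2 ≤ n → (r : ℕ) → (f : BoolFun n) →
    IsNCF f → RSymmetric r f →
    Σ (Rep n) λ R → Represents R f × DefaultNormalized R × layers R ≤ r)
corollary2 = layers-determine-symmetry , symmetric-NCF-has-few-layers
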